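{- Let $\Gamma$ be a locally semicomplete commutative weakly distance-regular digraph, let $q\geq4$ with $q\in T$, and suppose $(1,q-1)$ is pure. Let $r\in T$ with $r\neq q$. Then one of the following holds: (i) $r\in\{2,3\}$ and $\Gamma_{1,r-1}\Gamma_{1,q-1}=\{\Gamma_{1,q-1}\}$; (ii) $r=q+1$ and the configuration C$(q+1)$ exists.
   Context: Digraphs are finite with arcs being ordered pairs of distinct vertices; $N^\pm(x)$ out-/in-neighbourhoods; circuits of length $r$ are paths $(w_0,\dots,w_{r-1})$ with $(w_{r-1},w_0)$ an arc; $\partial$ distance, $\tilde\partial(x,y)=(\partial(x,y),\partial(y,x))$, $\tilde\partial(\Gamma)$ its value set. Weakly distance-regular: strongly connected and the number $p^{\tilde h}_{\tilde i,\tilde j}$ of $z$ with $\tilde\partial(x,z)=\tilde i$, $\tilde\partial(z,y)=\tilde j$ depends only on $\tilde h=\tilde\partial(x,y)$; commutative: $p^{\tilde h}_{\tilde i,\tilde j}=p^{\tilde h}_{\tilde j,\tilde i}$. Locally semicomplete: each $N^+(x)$, $N^-(x)$ induces a digraph in which any two distinct vertices are joined by at least one arc. $\Gamma_{a,b}$ is the set of pairs with two-way distance $(a,b)$. An arc $(x,y)$ has type $(1,r)$ if $\partial(y,x)=r$; $T=\{q:(1,q-1)\in\tilde\partial(\Gamma)\}$. For $q\in T$, $(1,q-1)$ is pure if every circuit of length $q$ containing an arc of type $(1,q-1)$ consists of arcs of type $(1,q-1)$. C$(q)$ exists if $p^{(1,q-2)}_{(1,q-1),(1,q-1)}\neq0$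 and $(1,q-2)$ is pure. $\Gamma_{\tilde i}\Gamma_{\tilde j}=\{\Gamma_{\tilde h}:p^{\tilde h}_{\tilde i,\tilde j}\neq0\}$. -}

module Defs where

open import Data.Nat using (ℕ; zero; suc; _∸_; _≡ᵇ_; _≤_)
open import Data.Bool using (Bool; true; false; _∧_; if_then_else_)
open import Data.Fin using (Fin; zero; suc; inject₁; fromℕ; _≟_)
open import Data.List using (List; allFin; filterᵇ; length)
open import Data.Bool.ListAction using (any)
open import Data.Product using (_×_; _,_; Σ; ∃; ∃-syntax)
open import Data.Sum using (_⊎_)
open import Relation.Binary.PropositionalEquality using (_≡_; _≢_)
open import Relation.Nullary using (¬_)
open import Relation.Nullary.Decidable using (⌊_⌋)
open import Function using (Injective; _⇔_)

record Digraph : Set where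
  field
    n      : ℕ
    arc    : Fin n → Fin n → Bool
    irrefl : ∀ x → arc x x ≡ false

module _ (Γ : Digraph) where
  open Digraph Γ

  Arc : Fin n → Fin n → Set
  Arc x y = arc x y ≡ true

  reach : ℕ → Fin n → Fin n → Bool
  reach zero    x y = ⌊ x ≟ y ⌋
  reach (suc k) x y = any (λ z → arc x z ∧ reach k z y) (allFin n)

  -- distance ∂(x,y): least k with a walk (equivalently a path) of length k
  -- from x to y, searching k = 0,1,…,n-1 (returns n if y is unreachable,
  -- which never happens in a strongly connected digraph).
  dist : Fin n → Fin n → ℕ
  dist x y = go 0 n
    where
    go : ℕ → ℕ → ℕ
    go k zero    = k
    go k (suc f) = if reach k x y then k else go (suc k) f

  tdist : Fin n → Fin n → ℕ × ℕ
  tdist x y = dist x y , dist y x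

  StronglyConnected : Set
  StronglyConnected = ∀ x y → ∃[ k ] reach k x y ≡ true

  eqPair : ℕ × ℕ → ℕ × ℕ → Bool
  eqPair (a , b) (c , d) = (a ≡ᵇ c) ∧ (b ≡ᵇ d)

  count : Fin n → Fin n → ℕ × ℕ → ℕ × ℕ → ℕ
  count x y i j =
    length (filterᵇ (λ z → eqPair (tdist x z) i ∧ eqPair (tdist z y) j) (allFin n))

  WeaklyDistanceRegular : Set
  WeaklyDistanceRegular =
    StronglyConnected ×
    (∀ x y x' y' → tdist x y ≡ tdist x' y' →
       ∀ i j → count x y i j ≡ count x' y' i j)

  Commutative : Set
  Commutative = ∀ x y i j → count x y i j ≡ count x y j i

  LocallySemicomplete : Set
  LocallySemicomplete =
    (∀ x y z → Arc x y → Arc x z → y ≢ z → Arc y z ⊎ Arc z y) ×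
    (∀ x y z → Arc y x → Arc z x → y ≢ z → Arc y z ⊎ Arc z y)

  -- p^h_{i,j} ≠ 0 (with h ∈ ∂̃(Γ)): some (x,y) with ∂̃(x,y)=h has count ≠ 0
  PNonzero : ℕ × ℕ → ℕ × ℕ → ℕ × ℕ → Set
  PNonzero h i j = ∃[ x ] ∃[ y ] (tdist x y ≡ h × ¬ (count x y i j ≡ 0))

  InT : ℕ → Set
  InT q = ∃[ x ] ∃[ y ] tdist x y ≡ (1 , q ∸ 1)

  -- circuit of length suc m: a path (w_0,…,w_m) of distinct vertices
  -- together with the arc (w_m , w_0)
  IsCircuit : (m : ℕ) → (Fin (suc m) → Fin n) → Set
  IsCircuit m w =
    Injective _≡_ _≡_ w ×
    (∀ (i : Fin m) → Arc (w (inject₁ i)) (w (suc i))) ×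
    Arc (w (fromℕ m)) (w zero)

  OnCircuit : (m : ℕ) → (Fin (suc m) → Fin n) → Fin n → Fin n → Set
  OnCircuit m w a b =
    (∃[ i ] (a ≡ w (inject₁ i) × b ≡ w (suc i))) ⊎
    (a ≡ w (fromℕ m) × b ≡ w zero)

  -- an arc (a,b) has type (1,r) iff ∂(b,a) = r
  HasType : ℕ → Fin n → Fin n → Set
  HasType r a b = Arc a b × dist b a ≡ r

  Pure : ℕ → Set
  Pure q = ∀ m (w : Fin (suc m) → Fin n) → suc m ≡ q → IsCircuit m w →
    (∃[ a ] ∃[ b ] (OnCircuit m w a b × HasType (q ∸ 1) a b)) →
    ∀ a b → OnCircuit m w a b → HasType (q ∸ 1) a b

  C : ℕ → Set
  C q = PNonzero (1 , q ∸ 2) (1 , q ∸ 1) (1 , q ∸ 1) × Pure (q ∸ 1)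

  ProdIsSingleton : ℕ × ℕ → ℕ × ℕ → ℕ × ℕ → Set
  ProdIsSingleton i j k = ∀ h → (PNonzero h i j ⇔ (h ≡ k))

{-# OPTIONS --safe #-}
module Submission where

-- Write m = q − 1, so that `HasType Γ m` is the arc type (1,q−1).  By purity every arc of type
-- (1,m) lies on a circuit v₀ → v₁ → ⋯ → v_m → v₀ all of whose arcs have type (1,m); such a circuit
-- is geodesic, and any z with v₀ → z → v₂ may replace v₁ in it.  With local semicompleteness this
-- controls the neighbours of a type-(1,m) arc (x₀,x₁): an arc x₀ → z of type (1,r−1), r ≠ q, forces
-- z → x₁.  If (z,x₁) is not of type (1,m), walking along shortest paths shows
-- ∂(z,x₀) = ∂(x₁,z) = m+1, i.e. r = q+1 and C(q+1).  If it is, weak distance-regularity yields an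
-- infinite sequence of vertices each dominating all earlier ones unless ∂(z,x₀) ≤ 2, so r ∈ {2,3};
-- and a counting argument on out-neighbourhoods of type (1,m) gives Γ_{1,r−1}Γ_{1,q−1} = {Γ_{1,q−1}}.

open import Defs
open import Data.Bool using (Bool; true; false; T; if_then_else_; _∧_)
open import Data.Bool.ListAction using (any)
open import Data.Bool.Properties using (T-∧; T-≡; T?)
open import Data.Empty using (⊥; ⊥-elim)
open import Data.Fin using (Fin; toℕ; fromℕ<)
open import Data.Fin.Properties
  using (pigeonhole; toℕ<n; toℕ-injective; toℕ≤pred[n]; toℕ-inject₁; toℕ-fromℕ; toℕ-fromℕ<)
open import Data.List using ([]; _∷_; allFin; filterᵇ; length)
open import Data.List.Membership.Propositional using (_∈_; lose)
open import Data.List.Membership.Propositional.Properties using (∈-allFin; ∈-filter⁺; ∈-filter⁻)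
open import Data.List.Properties using (filter-some)
open import Data.List.Relation.Binary.Pointwise using (Pointwise-≡⇒≡)
open import Data.List.Relation.Binary.Sublist.Propositional using (⊆-refl)
open import Data.List.Relation.Binary.Sublist.Propositional.Properties using (filter⁺; to-≋)
open import Data.List.Relation.Unary.Any using (here; satisfied)
open import Data.List.Relation.Unary.Any.Properties using (any⁺; any⁻)
open import Data.Nat using (ℕ; zero; suc; _+_; _∸_; _≤_; _<_; z≤n; s≤s; s≤s⁻¹; _<?_; _≟_; NonZero)
open import Data.Nat.DivMod
  using (_%_; _/_; m%n<n; m<n⇒m%n≡m; n%n≡0; [m+n]%n≡m%n; [m+kn]%n≡m%n; %-congˡ; m≡m%n+[m/n]*n)
open import Data.Nat.Induction using (<-wellFounded)
open import Data.Nat.Properties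
open import Algebra.Properties.CommutativeSemigroup +-commutativeSemigroup using (xy∙z≈xz∙y)
open import Data.Product using (_×_; _,_; proj₁; proj₂; ∃-syntax; Σ-syntax)
open import Data.Sum using (_⊎_; inj₁; inj₂)
open import Function using (_⇔_; Equivalence; _∘_; mk⇔)
open import Induction.WellFounded using (Acc; acc)
open import Relation.Binary.PropositionalEquality
open import Relation.Nullary using (¬_; yes; no)
open import Relation.Nullary.Decidable using (toWitness; fromWitness; decidable-stable)

open Equivalence using (to; from)

-- `dist` is computed by a search loop local to its definition.  The meta `search` is solved by
-- unification with that loop, which makes the loop available for induction.
mutual
  search : (Γ : Digraph) (x y : Fin (Digraph.n Γ)) → ℕ → ℕ → ℕ
  search = _

  private
    search-solution : ∀ F a irr x y → let Γ = record { n = suc F ; arc = a ; irrefl = irr } in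
      dist Γ x y ≡ (if reach Γ 0 x y then 0 else search Γ x y 1 F)
    search-solution F a irr x y with suc F | 1
    ... | _ | _ = refl

[1+m]%n≡[1+m%n]%n : ∀ m n .{{_ : NonZero n}} → suc m % n ≡ suc (m % n) % n
[1+m]%n≡[1+m%n]%n m n = trans (%-congˡ (cong suc (m≡m%n+[m/n]*n m n))) ([m+kn]%n≡m%n (suc (m % n)) (m / n) n)

%-suc-cases : ∀ n i → (i % suc n < n × suc i % suc n ≡ suc (i % suc n)) ⊎ (i % suc n ≡ n × suc i % suc n ≡ 0)
%-suc-cases n i with m≤n⇒m<n∨m≡n (m<1+n⇒m≤n (m%n<n i (suc n)))
... | inj₁ r<n = inj₁ (r<n , trans ([1+m]%n≡[1+m%n]%n i (suc n)) (m<n⇒m%n≡m (s≤s r<n)))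
... | inj₂ r≡n = inj₂ (r≡n , trans ([1+m]%n≡[1+m%n]%n i (suc n))
                                   (trans (cong (λ r → suc r % suc n) r≡n) (n%n≡0 (suc n))))

0<n≤2⇒1+n≡2⊎1+n≡3 : ∀ {n} → 0 < n → n ≤ 2 → suc n ≡ 2 ⊎ suc n ≡ 3
0<n≤2⇒1+n≡2⊎1+n≡3 {1}                 _ _                = inj₁ refl
0<n≤2⇒1+n≡2⊎1+n≡3 {2}                 _ _                = inj₂ refl
0<n≤2⇒1+n≡2⊎1+n≡3 {suc (suc (suc _))} _ (s≤s (s≤s ()))

module _ {A : Set} {p : A → Bool} where

  filterᵇ-nonempty : ∀ xs → length (filterᵇ p xs) ≢ 0 → ∃[ x ] T (p x)
  filterᵇ-nonempty xs ne with filterᵇ p xs in eq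
  ... | []    = ⊥-elim (ne refl)
  ... | x ∷ _ = x , proj₂ (∈-filter⁻ (T? ∘ p) {xs = xs} (subst (x ∈_) (sym eq) (here refl)))

module _ {A : Set} {p q : A → Bool} where

  filterᵇ-⊆-length : ∀ xs → (∀ {x} → T (p x) → T (q x)) →
                     length (filterᵇ p xs) ≡ length (filterᵇ q xs) →
                     ∀ {x} → x ∈ xs → T (q x) → T (p x)
  filterᵇ-⊆-length xs p⇒q same-length {x} x∈xs qx =
    proj₂ (∈-filter⁻ (T? ∘ p) {xs = xs} (subst (x ∈_) (sym filters-equal) (∈-filter⁺ (T? ∘ q) x∈xs qx)))
    where
    filters-equal : filterᵇ p xs ≡ filterᵇ q xs
    filters-equal = Pointwise-≡⇒≡ (to-≋ same-length
      (filter⁺ (T? ∘ p) (T? ∘ q) {as = xs} {bs = xs} (λ { refl → p⇒q }) ⊆-refl))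

module Walks (Γ : Digraph) where
  open Digraph Γ using (n; irrefl)

  V : Set
  V = Fin n

  infixr 5 _∷_ _++_

  data Walk : ℕ → V → V → Set where
    []  : ∀ {x} → Walk 0 x x
    _∷_ : ∀ {k x y z} → Arc Γ x y → Walk k y z → Walk (suc k) x z

  arc-irrefl : ∀ {x} → ¬ Arc Γ x x
  arc-irrefl {x} a = subst T (irrefl x) (from T-≡ a)

  reach⇒Walk : ∀ k {x y} → T (reach Γ k x y) → Walk k x y
  reach⇒Walk zero    r with refl ← toWitness r = []
  reach⇒Walk (suc k) {x} {y} r
    with z , p ← satisfied (any⁻ (λ z → Digraph.arc Γ x z ∧ reach Γ k z y) (allFin n) r)
    = to T-≡ (proj₁ (to T-∧ p)) ∷ reach⇒Walk k (proj₂ (to T-∧ p))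

  Walk⇒reach : ∀ {k x y} → Walk k x y → T (reach Γ k x y)
  Walk⇒reach []                 = fromWitness refl
  Walk⇒reach (_∷_ {y = y} a w) = any⁺ _ (lose (∈-allFin y) (from T-∧ (from T-≡ a , Walk⇒reach w)))

  _++_ : ∀ {a b x y z} → Walk a x y → Walk b y z → Walk (a + b) x z
  []      ++ v = v
  (a ∷ w) ++ v = a ∷ (w ++ v)

  Walk-unsnoc : ∀ {k x y} → Walk (suc k) x y → ∃[ v ] (Walk k x v × Arc Γ v y)
  Walk-unsnoc (a ∷ [])        = _ , [] , a
  Walk-unsnoc (a ∷ w@(_ ∷ _)) with v , w′ , b ← Walk-unsnoc w = v , a ∷ w′ , b

  IsWalk : (ℕ → V) → ℕ → Set
  IsWalk p k = ∀ {t} → t < k → Arc Γ (p t) (p (suc t))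

  sequence⇒Walk : ∀ k {p} → IsWalk p k → Walk k (p 0) (p k)
  sequence⇒Walk zero    w = []
  sequence⇒Walk (suc k) w = w (s≤s z≤n) ∷ sequence⇒Walk k (λ t<k → w (s≤s t<k))

  Walk⇒sequence : ∀ {k x y} → Walk k x y → ∃[ p ] (p 0 ≡ x × p k ≡ y × IsWalk p k)
  Walk⇒sequence {x = x} []       = (λ _ → x) , refl , refl , λ ()
  Walk⇒sequence {x = x} (a ∷ w) with p , refl , pk , pw ← Walk⇒sequence w
    = (λ { zero → x ; (suc t) → p t }) , refl , pk , λ { {zero} _ → a ; {suc t} (s≤s t<k) → pw t<k }

  sequence-segment : ∀ {p k i j} → IsWalk p k → i ≤ j → j ≤ k → Walk (j ∸ i) (p i) (p j)
  sequence-segment {p} {k} {i} {j} w i≤j j≤k =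
    subst (λ s → Walk (j ∸ i) (p i) (p s)) (m∸n+n≡m i≤j)
      (sequence⇒Walk (j ∸ i) {λ t → p (t + i)} λ t<j∸i →
        w (≤-trans (subst (_ <_) (m∸n+n≡m i≤j) (+-monoˡ-< i t<j∸i)) j≤k))

  ¬dominating-sequence : (w : ℕ → V) → ¬ (∀ {i j} → i < j → Arc Γ (w j) (w i))
  ¬dominating-sequence w dominates with i , j , i<j , wi≡wj ← pigeonhole (n<1+n n) (λ i → w (toℕ i))
    = arc-irrefl (subst (Arc Γ (w (toℕ j))) wi≡wj (dominates i<j))

  Walk-shorten : ∀ {k x y} → Walk k x y → n ≤ k → ∃[ k′ ] (k′ < k × Walk k′ x y)
  Walk-shorten {k} w n≤k
    with p , refl , refl , pw ← Walk⇒sequence w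
    with i , j , i<j , pi≡pj ← pigeonhole (n<1+n n) (λ i → p (toℕ i))
    = toℕ i + (k ∸ toℕ j) , shorter
    , sequence-segment pw z≤n (≤-trans (<⇒≤ i<j) j≤k)
      ++ subst (λ v → Walk (k ∸ toℕ j) v (p k)) (sym pi≡pj) (sequence-segment pw j≤k ≤-refl)
    where
    j≤k : toℕ j ≤ k
    j≤k = ≤-trans (m<1+n⇒m≤n (toℕ<n j)) n≤k
    shorter : toℕ i + (k ∸ toℕ j) < k
    shorter = subst (toℕ i + (k ∸ toℕ j) <_) (m+[n∸m]≡n j≤k) (+-monoˡ-< (k ∸ toℕ j) i<j)

  Walk-short : ∀ k {x y} → Walk k x y → ∃[ k′ ] (k′ ≤ k × k′ < n × Walk k′ x y)
  Walk-short k = go k (<-wellFounded k)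
    where
    go : ∀ k {x y} → Acc _<_ k → Walk k x y → ∃[ k′ ] (k′ ≤ k × k′ < n × Walk k′ x y)
    go k (acc rec) w with k <? n
    ... | yes k<n = k , ≤-refl , k<n , w
    ... | no k≮n
      with k′ , k′<k , w′ ← Walk-shorten w (≮⇒≥ k≮n)
      with k″ , k″≤k′ , k″<n , w″ ← go k′ (rec k′<k) w′
      = k″ , ≤-trans k″≤k′ (<⇒≤ k′<k) , k″<n , w″

  search-finds : ∀ {x y} f k {j} → Walk j x y → k ≤ j → j < f + k →
                 search Γ x y k f ≤ j × Walk (search Γ x y k f) x y
  search-finds         zero    k w k≤j j<k = ⊥-elim (<⇒≱ j<k k≤j)
  search-finds {x} {y} (suc f) k {j} w k≤j j<f+k with reach Γ k x y in found
  ... | true  = k≤j , reach⇒Walk k (subst T (sym found) _)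
  ... | false = search-finds f (suc k) w (≤∧≢⇒< k≤j k≢j) (subst (j <_) (sym (+-suc f k)) j<f+k)
    where
    k≢j : k ≢ j
    k≢j refl = subst T found (Walk⇒reach w)

  dist-minimal : ∀ {k x y} → Walk k x y → dist Γ x y ≤ k × Walk (dist Γ x y) x y
  dist-minimal {k} w with k′ , k′≤k , k′<n , w′ ← Walk-short k w
    with dist≤k′ , dist-walk ← search-finds n 0 w′ z≤n (subst (_ <_) (sym (+-identityʳ n)) k′<n)
    = ≤-trans dist≤k′ k′≤k , dist-walk

  dist-≤ : ∀ {k x y} → Walk k x y → dist Γ x y ≤ k
  dist-≤ w = proj₁ (dist-minimal w)

module Distance (Γ : Digraph) (sc : StronglyConnected Γ) where
  open Walks Γ public

  ∂ : V → V → ℕ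
  ∂ = dist Γ

  dist-walk : ∀ x y → Walk (∂ x y) x y
  dist-walk x y with k , r ← sc x y = proj₂ (dist-minimal (reach⇒Walk k (from T-≡ r)))

  dist-refl : ∀ x → ∂ x x ≡ 0
  dist-refl x = n≤0⇒n≡0 (dist-≤ [])

  ≡⇒dist≡0 : ∀ {x y} → x ≡ y → ∂ x y ≡ 0
  ≡⇒dist≡0 {x} refl = dist-refl x

  dist≡0⇒≡ : ∀ {x y} → ∂ x y ≡ 0 → x ≡ y
  dist≡0⇒≡ {x} {y} e with [] ← subst (λ k → Walk k x y) e (dist-walk x y) = refl

  triangle : ∀ x y z → ∂ x z ≤ ∂ x y + ∂ y z
  triangle x y z = dist-≤ (dist-walk x y ++ dist-walk y z)

  dist-arc : ∀ {x y} → Arc Γ x y → ∂ x y ≡ 1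
  dist-arc {x} {y} a with ∂ x y in e | dist-≤ (a ∷ [])
  ... | 0           | _       = ⊥-elim (arc-irrefl (subst (Arc Γ x) (sym (dist≡0⇒≡ e)) a))
  ... | 1           | _       = refl
  ... | suc (suc _) | s≤s ()

  dist≡1⇒arc : ∀ {x y} → ∂ x y ≡ 1 → Arc Γ x y
  dist≡1⇒arc {x} {y} e with a ∷ [] ← subst (λ k → Walk k x y) e (dist-walk x y) = a

  HasType⇒tdist : ∀ {k x y} → HasType Γ k x y → tdist Γ x y ≡ (1 , k)
  HasType⇒tdist (a , e) = cong₂ _,_ (dist-arc a) e

  tdist⇒HasType : ∀ {k x y} → tdist Γ x y ≡ (1 , k) → HasType Γ k x y
  tdist⇒HasType e = dist≡1⇒arc (cong proj₁ e) , cong proj₂ e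

  ¬HasType-0 : ∀ {x y} → ¬ HasType Γ 0 x y
  ¬HasType-0 {x} (a , e) = arc-irrefl (subst (Arc Γ x) (dist≡0⇒≡ e) a)

  dist-two-step : ∀ {x y z} → Arc Γ x y → Arc Γ y z → ∂ x z ≤ 2
  dist-two-step a b = dist-≤ (a ∷ b ∷ [])

  arc-then-dist : ∀ {x y z} → Arc Γ x y → ∂ x z ≤ suc (∂ y z)
  arc-then-dist {x} {y} {z} a = subst (λ d → ∂ x z ≤ d + ∂ y z) (dist-arc a) (triangle x y z)

  dist-then-arc : ∀ {x y z} → Arc Γ y z → ∂ x z ≤ suc (∂ x y)
  dist-then-arc {x} {y} {z} a =
    subst (∂ x z ≤_) (trans (cong (∂ x y +_) (dist-arc a)) (+-comm (∂ x y) 1)) (triangle x y z)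

  first-step : ∀ {k x y} → ∂ x y ≡ suc k → ∃[ u ] (Arc Γ x u × ∂ u y ≡ k)
  first-step {k} {x} {y} e with _∷_ {y = u} a w ← subst (λ k → Walk k x y) e (dist-walk x y)
    = u , a , ≤-antisym (dist-≤ w) (s≤s⁻¹ (subst (_≤ _) e (arc-then-dist a)))

  last-step : ∀ {k x y} → ∂ x y ≡ suc k → ∃[ v ] (Arc Γ v y × ∂ x v ≡ k)
  last-step {k} {x} {y} e with v , w , a ← Walk-unsnoc (subst (λ k → Walk k x y) e (dist-walk x y))
    = v , a , ≤-antisym (dist-≤ w) (s≤s⁻¹ (subst (_≤ _) e (dist-then-arc a)))

  module _ {p k} (walk : IsWalk p k) (geodesic : ∂ (p 0) (p k) ≡ k) where

    geodesic-segment : ∀ {i j} → i ≤ j → j ≤ k → ∂ (p i) (p j) ≡ j ∸ i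
    geodesic-segment {i} {j} i≤j j≤k =
      ≤-antisym (dist-≤ (sequence-segment walk i≤j j≤k))
                (m≤n+o⇒m∸n≤o j i (+-cancelʳ-≤ (k ∸ j) j _ lower))
      where
      open ≤-Reasoning
      lower : j + (k ∸ j) ≤ i + ∂ (p i) (p j) + (k ∸ j)
      lower = begin
        j + (k ∸ j)                              ≡⟨ m+[n∸m]≡n j≤k ⟩
        k                                        ≡⟨ geodesic ⟨
        ∂ (p 0) (p k)                            ≤⟨ triangle _ (p j) _ ⟩
        ∂ (p 0) (p j) + ∂ (p j) (p k)            ≤⟨ +-mono-≤ (triangle _ (p i) _)
                                                      (dist-≤ (sequence-segment walk j≤k ≤-refl)) ⟩
        ∂ (p 0) (p i) + ∂ (p i) (p j) + (k ∸ j)  ≤⟨ +-monoˡ-≤ (k ∸ j) (+-monoˡ-≤ (∂ (p i) (p j))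
                                                      (dist-≤ (sequence-segment walk z≤n (≤-trans i≤j j≤k)))) ⟩
        i + ∂ (p i) (p j) + (k ∸ j)              ∎

    geodesic-injective : ∀ {i j} → i ≤ k → j ≤ k → p i ≡ p j → i ≡ j
    geodesic-injective {i} {j} i≤k j≤k pi≡pj with ≤-total i j
    ... | inj₁ i≤j = ≤-antisym i≤j (m∸n≡0⇒m≤n (trans (sym (geodesic-segment i≤j j≤k)) (≡⇒dist≡0 pi≡pj)))
    ... | inj₂ j≤i = ≤-antisym (m∸n≡0⇒m≤n (trans (sym (geodesic-segment j≤i i≤k)) (≡⇒dist≡0 (sym pi≡pj)))) j≤i

module Counting (Γ : Digraph) where
  open Walks Γ using (V)

  Between : V → V → ℕ × ℕ → ℕ × ℕ → V → Set
  Between x y i j z = tdist Γ x z ≡ i × tdist Γ z y ≡ j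

  eqPair⇔≡ : ∀ {a b} → T (eqPair Γ a b) ⇔ a ≡ b
  eqPair⇔≡ {a₁ , a₂} {b₁ , b₂} = mk⇔
    (λ t → cong₂ _,_ (≡ᵇ⇒≡ a₁ b₁ (proj₁ (to T-∧ t))) (≡ᵇ⇒≡ a₂ b₂ (proj₂ (to T-∧ t))))
    (λ { refl → from T-∧ (≡⇒≡ᵇ a₁ a₁ refl , ≡⇒≡ᵇ a₂ a₂ refl) })

  between? : V → V → ℕ × ℕ → ℕ × ℕ → V → Bool
  between? x y i j z = eqPair Γ (tdist Γ x z) i ∧ eqPair Γ (tdist Γ z y) j

  between⇔ : ∀ {x y i j z} → T (between? x y i j z) ⇔ Between x y i j z
  between⇔ {x} {y} {i} {j} {z} =
    mk⇔ (λ t → to eqPair⇔≡ (proj₁ (to ∧⇔ t)) , to eqPair⇔≡ (proj₂ (to ∧⇔ t)))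
        (λ (e , e′) → from ∧⇔ (from eqPair⇔≡ e , from eqPair⇔≡ e′))
    where ∧⇔ = T-∧ {eqPair Γ (tdist Γ x z) i} {eqPair Γ (tdist Γ z y) j}

  tdist-swap : ∀ {x y a b} → tdist Γ x y ≡ (a , b) → tdist Γ y x ≡ (b , a)
  tdist-swap e = cong₂ _,_ (cong proj₂ e) (cong proj₁ e)

  count≢0⇒between : ∀ {x y i j} → count Γ x y i j ≢ 0 → ∃[ z ] Between x y i j z
  count≢0⇒between {x} {y} {i} {j} ne with z , t ← filterᵇ-nonempty {p = between? x y i j} (allFin _) ne
    = z , to between⇔ t

  between⇒count≢0 : ∀ {x y i j z} → Between x y i j z → count Γ x y i j ≢ 0
  between⇒count≢0 {x} {y} {i} {j} {z} b =
    n>0⇒n≢0 (filter-some (T? ∘ between? x y i j) (lose (∈-allFin z) (from between⇔ b)))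

  count-⊆-≡ : ∀ {x y i j x′ y′ i′ j′} → (∀ {z} → Between x y i j z → Between x′ y′ i′ j′ z) →
              count Γ x y i j ≡ count Γ x′ y′ i′ j′ → ∀ {z} → Between x′ y′ i′ j′ z → Between x y i j z
  count-⊆-≡ {x} {y} {i} {j} {x′} {y′} {i′} {j′} ⊆ same {z} b = to between⇔
    (filterᵇ-⊆-length {p = between? x y i j} {q = between? x′ y′ i′ j′} (allFin _)
      (λ t → from between⇔ (⊆ (to between⇔ t))) same (∈-allFin z) (from between⇔ b))

module Circuits (Γ : Digraph) (sc : StronglyConnected Γ) (m : ℕ) (pure : Pure Γ (suc m)) where
  open Distance Γ sc

  record Circuit : Set where
    field
      vertex    : ℕ → V
      injective : ∀ {i j} → i ≤ m → j ≤ m → vertex i ≡ vertex j → i ≡ j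
      walk      : IsWalk vertex m
      closing   : Arc Γ (vertex m) (vertex 0)

    cycle : Fin (suc m) → V
    cycle i = vertex (toℕ i)

    isCircuit : IsCircuit Γ m cycle
    isCircuit = (λ e → toℕ-injective (injective (toℕ≤pred[n] _) (toℕ≤pred[n] _) e))
              , (λ i → subst (λ t → Arc Γ (vertex t) (cycle (Fin.suc i))) (sym (toℕ-inject₁ i))
                             (walk (toℕ<n i)))
              , subst (λ t → Arc Γ (vertex t) (vertex 0)) (sym (toℕ-fromℕ m)) closing

    step-on : ∀ {t} → t < m → OnCircuit Γ m cycle (vertex t) (vertex (suc t))
    step-on t<m = inj₁ ( fromℕ< t<m
                       , cong vertex (sym (trans (toℕ-inject₁ _) (toℕ-fromℕ< t<m)))
                       , cong (vertex ∘ suc) (sym (toℕ-fromℕ< t<m)))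

    closing-on : OnCircuit Γ m cycle (vertex m) (vertex 0)
    closing-on = inj₂ (cong vertex (sym (toℕ-fromℕ m)) , refl)

    purity : ∀ {a b} → OnCircuit Γ m cycle a b → HasType Γ m a b →
             ∀ {a′ b′} → OnCircuit Γ m cycle a′ b′ → HasType Γ m a′ b′
    purity on typed on′ = pure m cycle refl isCircuit (_ , _ , on , typed) _ _ on′

  record TypedCircuit : Set where
    field
      vertex   : ℕ → V
      periodic : ∀ i → vertex (i + suc m) ≡ vertex i
      typed    : ∀ i → HasType Γ m (vertex i) (vertex (suc i))

    walk : IsWalk vertex m
    walk {t} _ = proj₁ (typed t)

    spans : ∂ (vertex 0) (vertex m) ≡ m
    spans = subst (λ v → ∂ v (vertex m) ≡ m) (periodic 0) (proj₂ (typed m))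

    geodesic : ∀ {i j} → i ≤ j → j ≤ m → ∂ (vertex i) (vertex j) ≡ j ∸ i
    geodesic = geodesic-segment walk spans

    injective : ∀ {i j} → i ≤ m → j ≤ m → vertex i ≡ vertex j → i ≡ j
    injective = geodesic-injective walk spans

  rotate : ℕ → TypedCircuit → TypedCircuit
  rotate s c = record
    { vertex   = λ i → vertex (i + s)
    ; periodic = λ i → trans (cong vertex (xy∙z≈xz∙y i (suc m) s)) (periodic (i + s))
    ; typed    = λ i → typed (i + s)
    }
    where open TypedCircuit c

  pure-circuit : (C : Circuit) → ∀ {a b} → OnCircuit Γ m (Circuit.cycle C) a b → HasType Γ m a b → TypedCircuit
  pure-circuit C on ab-typed = record
    { vertex   = λ i → vertex (i % suc m)
    ; periodic = λ i → cong vertex ([m+n]%n≡m%n i (suc m))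
    ; typed    = typed
    }
    where
    open Circuit C
    typed : ∀ i → HasType Γ m (vertex (i % suc m)) (vertex (suc i % suc m))
    typed i with %-suc-cases m i
    ... | inj₁ (r<m , e) rewrite e       = purity on ab-typed (step-on r<m)
    ... | inj₂ (r≡m , e) rewrite e | r≡m = purity on ab-typed closing-on

  open TypedCircuit using (vertex; periodic; typed; geodesic)

  through-arc : ∀ {a b} → HasType Γ m a b → Σ[ c ∈ TypedCircuit ] (vertex c 0 ≡ a × vertex c 1 ≡ b)
  through-arc {a} {b} (ab , ∂ba≡m)
    with p , refl , refl , pw ← Walk⇒sequence (subst (λ k → Walk k b a) ∂ba≡m (dist-walk b a))
    = rotate m (pure-circuit shortest (Circuit.closing-on shortest) (ab , ∂ba≡m))
    , cong p (m<n⇒m%n≡m (n<1+n m)) , cong p (n%n≡0 (suc m))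
    where
    shortest : Circuit
    shortest = record { vertex = p ; injective = geodesic-injective pw ∂ba≡m ; walk = pw ; closing = ab }

  through-arc′ : ∀ {a b} → HasType Γ m a b → Σ[ c ∈ TypedCircuit ] (vertex c 1 ≡ a × vertex c 2 ≡ b)
  through-arc′ ab with c , refl , refl ← through-arc ab = rotate m c , periodic c 0 , periodic c 1

  -- Replacing v₁ by z in c gives a circuit of length m + 1 containing the type-(1,m) arc (v_m , v₀),
  -- so purity applies to it.
  detour : (c : TypedCircuit) → 2 ≤ m → ∀ {z} → Arc Γ (vertex c 0) z → Arc Γ z (vertex c 2) →
           HasType Γ m (vertex c 0) z × HasType Γ m z (vertex c 2)
  detour c 2≤m {z} v₀z zv₂ = purity closing-on known (step-on (≤-trans (s≤s z≤n) 2≤m))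
                           , purity closing-on known (step-on 2≤m)
    where
    v = vertex c

    u : ℕ → V
    u 1 = z
    u t = v t

    old : ∀ {t} → t ≢ 1 → u t ≡ v t
    old {0}           _   = refl
    old {1}           t≢1 = ⊥-elim (t≢1 refl)
    old {suc (suc t)} _   = refl

    fresh : ∀ {j} → j ≤ m → j ≢ 1 → z ≢ v j
    fresh j≤m j≢1 z≡vj =
      j≢1 (trans (sym (geodesic c z≤n j≤m)) (trans (cong (∂ (v 0)) (sym z≡vj)) (dist-arc v₀z)))

    u-injective : ∀ {i j} → i ≤ m → j ≤ m → u i ≡ u j → i ≡ j
    u-injective {i} {j} i≤m j≤m e with i ≟ 1 | j ≟ 1
    ... | yes refl | yes refl = refl
    ... | yes refl | no j≢1   = ⊥-elim (fresh j≤m j≢1 (trans e (old j≢1)))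
    ... | no i≢1   | yes refl = ⊥-elim (fresh i≤m i≢1 (trans (sym e) (old i≢1)))
    ... | no i≢1   | no j≢1   = TypedCircuit.injective c i≤m j≤m (trans (sym (old i≢1)) (trans e (old j≢1)))

    u-walk : IsWalk u m
    u-walk {0}           _ = v₀z
    u-walk {1}           _ = zv₂
    u-walk {suc (suc t)} _ = proj₁ (typed c (suc (suc t)))

    known : HasType Γ m (u m) (u 0)
    known = subst₂ (HasType Γ m) (sym (old (λ m≡1 → <⇒≱ 2≤m (≤-reflexive m≡1)))) (periodic c 0) (typed c m)

    rerouted : Circuit
    rerouted = record { vertex = u ; injective = u-injective ; walk = u-walk ; closing = proj₁ known }

    open Circuit rerouted using (purity; step-on; closing-on)

module LocalStructure (Γ : Digraph) (sc : StronglyConnected Γ) (lsc : LocallySemicomplete Γ)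
                      (m : ℕ) (3≤m : 3 ≤ m) (pure : Pure Γ (suc m)) where
  open Distance Γ sc
  open Circuits Γ sc m pure
  open TypedCircuit using (vertex; typed; geodesic; injective)

  out-semicomplete = proj₁ lsc
  in-semicomplete  = proj₂ lsc

  private
    2≤m : 2 ≤ m
    2≤m = ≤-trans (n≤1+n 2) 3≤m

  typed-far-back : ∀ {a b} → HasType Γ m a b → ¬ ∂ b a ≤ 2
  typed-far-back (_ , ∂ba≡m) ∂ba≤2 = <⇒≱ 3≤m (subst (_≤ 2) ∂ba≡m ∂ba≤2)

  typed-¬digon : ∀ {a b} → HasType Γ m a b → ¬ Arc Γ b a
  typed-¬digon ab ba = typed-far-back ab (≤-trans (≤-reflexive (dist-arc ba)) (s≤s z≤n))

  module Window (c : TypedCircuit) where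
    private
      v = vertex c

    v₀≢v₂ : v 0 ≢ v 2
    v₀≢v₂ e with () ← injective c z≤n 2≤m e

    ¬v₀→v₂ : ¬ Arc Γ (v 0) (v 2)
    ¬v₀→v₂ a with () ← trans (sym (dist-arc a)) (geodesic c z≤n 2≤m)

    ¬v₂→v₀ : ¬ Arc Γ (v 2) (v 0)
    ¬v₂→v₀ a = typed-far-back (typed c 0) (dist-two-step (proj₁ (typed c 1)) a)

    arc-to-v₁ : ∀ {z} → Arc Γ (v 0) z → z ≢ v 1 → ∂ z (v 0) ≢ m → Arc Γ z (v 1)
    arc-to-v₁ {z} v₀z z≢v₁ ¬typed
      with out-semicomplete (v 0) (v 1) z (proj₁ (typed c 0)) v₀z (z≢v₁ ∘ sym)
    ... | inj₂ zv₁ = zv₁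
    ... | inj₁ v₁z with out-semicomplete (v 1) (v 2) z (proj₁ (typed c 1)) v₁z (λ { refl → ¬v₀→v₂ v₀z })
    ...   | inj₂ zv₂ = ⊥-elim (¬typed (proj₂ (proj₁ (detour c 2≤m v₀z zv₂))))
    ...   | inj₁ v₂z with in-semicomplete z (v 0) (v 2) v₀z v₂z v₀≢v₂
    ...     | inj₁ a = ⊥-elim (¬v₀→v₂ a)
    ...     | inj₂ a = ⊥-elim (¬v₂→v₀ a)

    arc-from-v₁ : ∀ {z} → Arc Γ z (v 2) → z ≢ v 1 → ∂ (v 2) z ≢ m → Arc Γ (v 1) z
    arc-from-v₁ {z} zv₂ z≢v₁ ¬typed
      with in-semicomplete (v 2) (v 1) z (proj₁ (typed c 1)) zv₂ (z≢v₁ ∘ sym)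
    ... | inj₁ v₁z = v₁z
    ... | inj₂ zv₁ with in-semicomplete (v 1) (v 0) z (proj₁ (typed c 0)) zv₁ (λ { refl → ¬v₀→v₂ zv₂ })
    ...   | inj₁ v₀z = ⊥-elim (¬typed (proj₂ (proj₂ (detour c 2≤m v₀z zv₂))))
    ...   | inj₂ zv₀ with out-semicomplete z (v 0) (v 2) zv₀ zv₂ v₀≢v₂
    ...     | inj₁ a = ⊥-elim (¬v₀→v₂ a)
    ...     | inj₂ a = ⊥-elim (¬v₂→v₀ a)

    ¬digon-v₁-to-v₂ : ∀ {z} → Arc Γ (v 1) z → Arc Γ z (v 1) → Arc Γ z (v 2) → ∂ (v 2) z ≢ m → ⊥
    ¬digon-v₁-to-v₂ {z} v₁z zv₁ zv₂ ¬typed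
      with in-semicomplete (v 1) (v 0) z (proj₁ (typed c 0)) zv₁ (λ { refl → typed-¬digon (typed c 0) v₁z })
    ... | inj₁ v₀z = ¬typed (proj₂ (proj₂ (detour c 2≤m v₀z zv₂)))
    ... | inj₂ zv₀ = typed-far-back (typed c 0) (dist-two-step v₁z zv₀)

    ¬digon-v₀-to-v₁ : ∀ {z} → Arc Γ (v 1) z → Arc Γ z (v 1) → Arc Γ (v 0) z → ∂ z (v 0) ≢ m → ⊥
    ¬digon-v₀-to-v₁ {z} v₁z zv₁ v₀z ¬typed
      with out-semicomplete (v 1) (v 2) z (proj₁ (typed c 1)) v₁z (λ { refl → typed-¬digon (typed c 1) zv₁ })
    ... | inj₁ v₂z = typed-far-back (typed c 1) (dist-two-step v₂z zv₁)
    ... | inj₂ zv₂ = ¬typed (proj₂ (proj₁ (detour c 2≤m v₀z zv₂)))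

  arc-to-head : ∀ {a b z} → HasType Γ m a b → Arc Γ a z → z ≢ b → ∂ z a ≢ m → Arc Γ z b
  arc-to-head ab with c , refl , refl ← through-arc ab = Window.arc-to-v₁ c

  arc-from-tail : ∀ {a b z} → HasType Γ m a b → Arc Γ z b → z ≢ a → ∂ b z ≢ m → Arc Γ a z
  arc-from-tail ab with c , refl , refl ← through-arc′ ab = Window.arc-from-v₁ c

  ¬digon-at-tail : ∀ {a b z} → HasType Γ m a b → Arc Γ a z → Arc Γ z a → Arc Γ z b → ∂ b z ≢ m → ⊥
  ¬digon-at-tail ab with c , refl , refl ← through-arc′ ab = Window.¬digon-v₁-to-v₂ c

  ¬digon-at-head : ∀ {a b z} → HasType Γ m a b → Arc Γ b z → Arc Γ z b → Arc Γ a z → ∂ z a ≢ m → ⊥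
  ¬digon-at-head ab with c , refl , refl ← through-arc ab = Window.¬digon-v₀-to-v₁ c

  module _ {x₀ x₁} (typed₀₁ : HasType Γ m x₀ x₁) where

    private
      ∂x₁x₀≡m : ∂ x₁ x₀ ≡ m
      ∂x₁x₀≡m = proj₂ typed₀₁

    ¬short-return : ∀ k {z} → ∂ z x₀ ≡ suc k → suc k < m → Arc Γ x₀ z → Arc Γ z x₁ → ∂ x₁ z ≢ m → ⊥
    ¬short-return zero    e _ x₀z zx₁ ¬typed = ¬digon-at-tail typed₀₁ x₀z (dist≡1⇒arc e) zx₁ ¬typed
    ¬short-return (suc k) {z} e k<m x₀z zx₁ ¬typed
      with u , zu , ∂ux₀ ← first-step e
      with out-semicomplete z u x₁ zu zx₁ (λ { refl → <⇒≢ (<-trans (n<1+n _) k<m) (trans (sym ∂ux₀) ∂x₁x₀≡m) })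
    ... | inj₂ x₁u = <⇒≱ k<m (subst (_≤ _) ∂x₁x₀≡m (subst (λ d → _ ≤ suc d) ∂ux₀ (arc-then-dist x₁u)))
    ... | inj₁ ux₁ with ∂ x₁ u ≟ m
    ...   | yes ∂x₁u≡m = ¬digon-at-tail (ux₁ , ∂x₁u≡m)
                           (arc-from-tail (ux₁ , ∂x₁u≡m) zx₁ (λ { refl → arc-irrefl zu }) ¬typed) zu zx₁ ¬typed
    ...   | no ¬typed′ = ¬short-return k ∂ux₀ (<-trans (n<1+n _) k<m)
                           (arc-from-tail typed₀₁ ux₁ (λ { refl → 0≢1+n (trans (sym (dist-refl x₀)) ∂ux₀) })
                                          ¬typed′)
                           ux₁ ¬typed′

    ¬short-departure : ∀ k {z} → ∂ x₁ z ≡ suc k → suc k < m → Arc Γ z x₁ → Arc Γ x₀ z → ∂ z x₀ ≢ m → ⊥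
    ¬short-departure zero    e _ zx₁ x₀z ¬typed = ¬digon-at-head typed₀₁ (dist≡1⇒arc e) zx₁ x₀z ¬typed
    ¬short-departure (suc k) {z} e k<m zx₁ x₀z ¬typed
      with v , vz , ∂x₁v ← last-step e
      with in-semicomplete z x₀ v x₀z vz (λ { refl → <⇒≢ (<-trans (n<1+n _) k<m) (trans (sym ∂x₁v) ∂x₁x₀≡m) })
    ... | inj₂ vx₀ = <⇒≱ k<m (subst (_≤ _) ∂x₁x₀≡m (subst (λ d → _ ≤ suc d) ∂x₁v (dist-then-arc vx₀)))
    ... | inj₁ x₀v with ∂ v x₀ ≟ m
    ...   | yes ∂vx₀≡m = ¬digon-at-head (x₀v , ∂vx₀≡m) vz
                           (arc-to-head (x₀v , ∂vx₀≡m) x₀z (λ { refl → arc-irrefl vz }) ¬typed) x₀z ¬typed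
    ...   | no ¬typed′ = ¬short-departure k ∂x₁v (<-trans (n<1+n _) k<m)
                           (arc-to-head typed₀₁ x₀v (λ { refl → 0≢1+n (trans (sym (dist-refl x₁)) ∂x₁v) })
                                        ¬typed′)
                           x₀v ¬typed′

    far-return : ∀ {z} → Arc Γ x₀ z → Arc Γ z x₁ → ∂ x₁ z ≢ m → m ≤ ∂ z x₀
    far-return {z} x₀z zx₁ ¬typed with ∂ z x₀ in e
    ... | zero  = ⊥-elim (arc-irrefl (subst (Arc Γ x₀) (dist≡0⇒≡ e) x₀z))
    ... | suc k = ≮⇒≥ λ k<m → ¬short-return k e k<m x₀z zx₁ ¬typed

    far-departure : ∀ {z} → Arc Γ z x₁ → Arc Γ x₀ z → ∂ z x₀ ≢ m → m ≤ ∂ x₁ z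
    far-departure {z} zx₁ x₀z ¬typed with ∂ x₁ z in e
    ... | zero  = ⊥-elim (arc-irrefl (subst (Arc Γ z) (dist≡0⇒≡ e) zx₁))
    ... | suc k = ≮⇒≥ λ k<m → ¬short-departure k e k<m zx₁ x₀z ¬typed

module Regular (Γ : Digraph) (lsc : LocallySemicomplete Γ) (wdr : WeaklyDistanceRegular Γ)
               (m : ℕ) (3≤m : 3 ≤ m) (pure : Pure Γ (suc m)) where
  open Distance Γ (proj₁ wdr)
  open LocalStructure Γ (proj₁ wdr) lsc m 3≤m pure
  open Counting Γ

  between-transfer : ∀ {x y x′ y′ i j z} → tdist Γ x y ≡ tdist Γ x′ y′ → Between x y i j z →
                     ∃[ z′ ] Between x′ y′ i j z′
  between-transfer e b = count≢0⇒between λ c′≡0 → between⇒count≢0 b (trans (proj₂ wdr _ _ _ _ e _ _) c′≡0)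

  tdist-refl : ∀ x y → tdist Γ x x ≡ tdist Γ y y
  tdist-refl x y = cong₂ _,_ (trans (dist-refl x) (sym (dist-refl y))) (trans (dist-refl x) (sym (dist-refl y)))

  typed-loop : ∀ {x y} → HasType Γ m x y → Between x x (1 , m) (m , 1) y
  typed-loop t = HasType⇒tdist t , tdist-swap (HasType⇒tdist t)

  typed-out-arc : InT Γ (suc m) → ∀ x → ∃[ y ] HasType Γ m x y
  typed-out-arc (a , b , ab) x with y , xy , _ ← between-transfer (tdist-refl a x) (ab , tdist-swap ab)
    = y , tdist⇒HasType xy

  -- Let k = ∂(z,x₀) ≥ 3.  As ∂̃(z,x₀) = (k,1) and (x₀,x₁) has type (1,m), regularity gives for every b
  -- with (b,x₁) of type (1,m) some v with ∂̃(b,v) = (k,1) and (v,x₁) of type (1,m).  Iterating from x₀,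
  -- local semicompleteness at x₁ makes each term dominate all earlier ones: impossible in a finite digraph.
  short-return : ∀ {x₀ x₁ z} → HasType Γ m x₀ x₁ → Arc Γ x₀ z → HasType Γ m z x₁ → ∂ z x₀ ≤ 2
  short-return {x₀} {x₁} {z} t₀₁ x₀z tz₁ = ≮⇒≥ λ 2<k → ¬dominating-sequence u (dominates 2<k)
    where
    k = ∂ z x₀

    step : ∀ {b} → HasType Γ m b x₁ → ∃[ v ] (tdist Γ b v ≡ (k , 1) × HasType Γ m v x₁)
    step tb with v , bv , vx₁ ← between-transfer (trans (HasType⇒tdist tz₁) (sym (HasType⇒tdist tb)))
                                                 (cong (k ,_) (dist-arc x₀z) , HasType⇒tdist t₀₁)
      = v , bv , tdist⇒HasType vx₁

    sequence : ℕ → Σ[ b ∈ V ] HasType Γ m b x₁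
    sequence zero    = x₀ , t₀₁
    sequence (suc i) = proj₁ (step (proj₂ (sequence i))) , proj₂ (proj₂ (step (proj₂ (sequence i))))

    u : ℕ → V
    u i = proj₁ (sequence i)

    forward : ∀ i → tdist Γ (u i) (u (suc i)) ≡ (k , 1)
    forward i = proj₁ (proj₂ (step (proj₂ (sequence i))))

    to-x₁ : ∀ i → Arc Γ (u i) x₁
    to-x₁ i = proj₁ (proj₂ (sequence i))

    module _ (2<k : 2 < k) where

      ¬forward-arc : ∀ {i} → ¬ Arc Γ (u i) (u (suc i))
      ¬forward-arc {i} a = <⇒≢ (<-trans (n<1+n 1) 2<k) (trans (sym (dist-arc a)) (cong proj₁ (forward i)))

      dominates : ∀ {i j} → i < j → Arc Γ (u j) (u i)
      dominates {i} {suc j} (s≤s i≤j) with m≤n⇒m<n∨m≡n i≤j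
      ... | inj₂ refl = dist≡1⇒arc (cong proj₂ (forward j))
      ... | inj₁ i<j
        with in-semicomplete x₁ (u i) (u (suc j)) (to-x₁ i) (to-x₁ (suc j))
                             (λ e → ¬forward-arc {j} (subst (Arc Γ (u j)) e (dominates i<j)))
      ...   | inj₂ a = a
      ...   | inj₁ a =
        ⊥-elim (<⇒≱ 2<k (subst (_≤ 2) (cong proj₁ (forward j)) (dist-two-step (dominates i<j) a)))

  -- The type-(1,m) out-neighbours of x are among those of w, and both sets have the same size.
  typed-product : ∀ {ℓ x w y} → ℓ < m → HasType Γ ℓ x w → HasType Γ m w y → HasType Γ m x y
  typed-product {ℓ} {x} {w} ℓ<m (xw , ∂wx≡ℓ) wy =
    tdist⇒HasType (proj₁ (count-⊆-≡ out-x⊆out-w (proj₂ wdr x x w w (tdist-refl x w) _ _) (typed-loop wy)))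
    where
    ∂wx≢m : ∂ w x ≢ m
    ∂wx≢m e = <⇒≢ ℓ<m (trans (sym ∂wx≡ℓ) e)

    typed-from-w : ∀ {e} → HasType Γ m x e → HasType Γ m w e
    typed-from-w {e} xe = we , decidable-stable (∂ e w ≟ m)
      λ ∂ew≢m → <⇒≱ ℓ<m (subst (m ≤_) ∂wx≡ℓ (far-return xe xw we ∂ew≢m))
      where
      we = arc-to-head xe xw (λ { refl → ∂wx≢m (proj₂ xe) }) ∂wx≢m

    out-x⊆out-w : ∀ {e} → Between x x (1 , m) (m , 1) e → Between w w (1 , m) (m , 1) e
    out-x⊆out-w (xe , _) = typed-loop (typed-from-w (tdist⇒HasType xe))

  product-singleton : ∀ {ℓ x₀ x₁ z} → ℓ < m → HasType Γ m x₀ x₁ → HasType Γ ℓ x₀ z → HasType Γ m z x₁ →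
                      ProdIsSingleton Γ (1 , ℓ) (1 , m) (1 , m)
  product-singleton ℓ<m t₀₁ t₀z tz₁ h = mk⇔
    (λ (x , y , xy≡h , count≢0) → let w , xw , wy = count≢0⇒between count≢0 in
      trans (sym xy≡h) (HasType⇒tdist (typed-product ℓ<m (tdist⇒HasType xw) (tdist⇒HasType wy))))
    (λ { refl → _ , _ , HasType⇒tdist t₀₁ , between⇒count≢0 (HasType⇒tdist t₀z , HasType⇒tdist tz₁) })

  closing-arc : ∀ {ℓ x₀ x₁ z} → HasType Γ m x₀ x₁ → HasType Γ ℓ x₀ z → ℓ ≢ m → Arc Γ z x₁
  closing-arc t₀₁@(_ , ∂x₁x₀≡m) (x₀z , ∂zx₀≡ℓ) ℓ≢m =
    arc-to-head t₀₁ x₀z (λ { refl → ℓ≢m (trans (sym ∂zx₀≡ℓ) ∂x₁x₀≡m) }) (ℓ≢m ∘ trans (sym ∂zx₀≡ℓ))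

  typed-closing : ∀ {ℓ x₀ x₁ z} → HasType Γ m x₀ x₁ → HasType Γ ℓ x₀ z → HasType Γ m z x₁ →
                  (suc ℓ ≡ 2 ⊎ suc ℓ ≡ 3) × ProdIsSingleton Γ (1 , ℓ) (1 , m) (1 , m)
  typed-closing {ℓ} t₀₁ t₀z@(x₀z , ∂zx₀≡ℓ) tz₁ =
    0<n≤2⇒1+n≡2⊎1+n≡3 (n≢0⇒n>0 λ { refl → ¬HasType-0 t₀z }) ℓ≤2
    , product-singleton (≤-<-trans ℓ≤2 3≤m) t₀₁ t₀z tz₁
    where
    ℓ≤2 : ℓ ≤ 2
    ℓ≤2 = subst (_≤ 2) ∂zx₀≡ℓ (short-return t₀₁ x₀z tz₁)

  untyped-closing : ∀ {ℓ x₀ x₁ z} → HasType Γ m x₀ x₁ → HasType Γ ℓ x₀ z → Arc Γ z x₁ → ℓ ≢ m → ∂ x₁ z ≢ m →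
                    suc ℓ ≡ suc (suc m) × C Γ (suc (suc m))
  untyped-closing {ℓ} {x₀} {x₁} {z} t₀₁@(_ , ∂x₁x₀≡m) (x₀z , ∂zx₀≡ℓ) zx₁ ℓ≢m ∂x₁z≢m =
    cong suc (trans (sym ∂zx₀≡ℓ) ∂zx₀≡1+m)
    , ( x₀ , x₁ , HasType⇒tdist t₀₁
      , between⇒count≢0 (HasType⇒tdist (x₀z , ∂zx₀≡1+m) , HasType⇒tdist (zx₁ , ∂x₁z≡1+m)))
    , pure
    where
    ∂zx₀≢m : ∂ z x₀ ≢ m
    ∂zx₀≢m = ℓ≢m ∘ trans (sym ∂zx₀≡ℓ)

    ∂zx₀≡1+m : ∂ z x₀ ≡ suc m
    ∂zx₀≡1+m = ≤-antisym (subst (λ d → ∂ z x₀ ≤ suc d) ∂x₁x₀≡m (arc-then-dist zx₁))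
                         (≤∧≢⇒< (far-return t₀₁ x₀z zx₁ ∂x₁z≢m) (≢-sym ∂zx₀≢m))

    ∂x₁z≡1+m : ∂ x₁ z ≡ suc m
    ∂x₁z≡1+m = ≤-antisym (subst (λ d → ∂ x₁ z ≤ suc d) ∂x₁x₀≡m (dist-then-arc x₀z))
                         (≤∧≢⇒< (far-departure t₀₁ zx₁ x₀z ∂zx₀≢m) (≢-sym ∂x₁z≢m))

  dichotomy : InT Γ (suc m) → ∀ {ℓ} → InT Γ (suc ℓ) → ℓ ≢ m →
              ((suc ℓ ≡ 2 ⊎ suc ℓ ≡ 3) × ProdIsSingleton Γ (1 , ℓ) (1 , m) (1 , m))
              ⊎ (suc ℓ ≡ suc (suc m) × C Γ (suc (suc m)))
  dichotomy q∈T (x₀ , z , x₀z) ℓ≢m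
    with x₁ , t₀₁ ← typed-out-arc q∈T x₀
    with t₀z ← tdist⇒HasType x₀z
    with ∂ x₁ z ≟ m
  ... | yes ∂x₁z≡m = inj₁ (typed-closing t₀₁ t₀z (closing-arc t₀₁ t₀z ℓ≢m , ∂x₁z≡m))
  ... | no  ∂x₁z≢m = inj₂ (untyped-closing t₀₁ t₀z (closing-arc t₀₁ t₀z ℓ≢m) ℓ≢m ∂x₁z≢m)

lemma6p2 : (Γ : Digraph) → LocallySemicomplete Γ → WeaklyDistanceRegular Γ → Commutative Γ →
  (q : ℕ) → 4 ≤ q → InT Γ q → Pure Γ q →
  (r : ℕ) → InT Γ r → r ≢ q →
  (((r ≡ 2 ⊎ r ≡ 3) × ProdIsSingleton Γ (1 , r ∸ 1) (1 , q ∸ 1) (1 , q ∸ 1))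
   ⊎ (r ≡ suc q × C Γ (suc q)))
lemma6p2 Γ lsc wdr _ (suc m) (s≤s 3≤m) q∈T pure zero    (_ , _ , xy) _   =
  ⊥-elim (Distance.¬HasType-0 Γ (proj₁ wdr) (Distance.tdist⇒HasType Γ (proj₁ wdr) xy))
lemma6p2 Γ lsc wdr _ (suc m) (s≤s 3≤m) q∈T pure (suc ℓ) r∈T r≢q =
  Regular.dichotomy Γ lsc wdr m 3≤m pure q∈T r∈T (r≢q ∘ cong suc)
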